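{- Let $\Gamma\neq\mathbb N$ be a complete intersection numerical semigroup minimally generated by $\{r_0,\ldots,r_h\}$. If $\mathrm m(\Gamma)\neq 2$, then $r_k<\mathrm F(\Gamma)$ for all $k\in\{0,\ldots,h\}$.
   Context: A numerical semigroup is a submonoid $\Gamma$ of $(\mathbb N,+)$ with finite complement in $\mathbb N$; $\mathrm F(\Gamma)$ denotes the largest integer not in $\Gamma$ and $\mathrm m(\Gamma)$ the smallest positive element of $\Gamma$. $\Gamma$ has a unique minimal generating set $\{r_0,\ldots,r_h\}$, whose cardinality $h+1$ is the embedding dimension $\mathrm e(\Gamma)$. The map $\varphi:\mathbb N^{h+1}\to\Gamma$, $\varphi(a_0,\ldots,a_h)=\sum a_ir_i$, is a monoid epimorphism with kernel congruence $\{(a,b):\varphi(a)=\varphi(b)\}$; a minimal presentation is a generating set of this congruence minimal with respect to inclusion (its cardinality is at least $\mathrm e(\Gamma)-1$). $\Gamma$ is a complete intersection if a minimal presentation has cardinality exactly $\mathrm e(\Gamma)-1$. -}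

module Defs where

open import Data.Nat using (ℕ; zero; suc; _+_; _*_; _<_; _≤_)
open import Data.Fin using (Fin)
open import Data.Vec using (Vec; lookup; zipWith; sum)
open import Data.List using (List; length)
open import Data.List.Membership.Propositional using (_∈_)
open import Data.List.Relation.Unary.Unique.Propositional using (Unique)
open import Data.Product using (_×_; ∃; ∃-syntax; Σ)
open import Relation.Binary.PropositionalEquality using (_≡_)
open import Relation.Nullary using (¬_)

φ : ∀ {n} → Vec ℕ n → Vec ℕ n → ℕ
φ r a = sum (zipWith _*_ a r)

InΓ : ∀ {n} → Vec ℕ n → ℕ → Set
InΓ {n} r x = ∃[ a ] φ {n} r a ≡ x

IsNumericalSemigroup : ∀ {n} → Vec ℕ n → Set
IsNumericalSemigroup r = ∃[ N ] (∀ x → N ≤ x → InΓ r x)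

IsMinimalGenerating : ∀ {n} → Vec ℕ n → Set
IsMinimalGenerating {n} r =
  (∀ (i j : Fin n) → lookup r i ≡ lookup r j → i ≡ j) ×
  (∀ (i : Fin n) → ¬ (∃[ a ] (lookup a i ≡ 0 × φ r a ≡ lookup r i)))

IsFrobenius : ∀ {n} → Vec ℕ n → ℕ → Set
IsFrobenius r f = ¬ InΓ r f × (∀ x → f < x → InΓ r x)

IsMultiplicity : ∀ {n} → Vec ℕ n → ℕ → Set
IsMultiplicity r m = InΓ r m × 0 < m × (∀ x → InΓ r x → 0 < x → m ≤ x)

_⊕_ : ∀ {n} → Vec ℕ n → Vec ℕ n → Vec ℕ n
a ⊕ b = zipWith _+_ a b

data Cong {n} (ρ : List (Vec ℕ n × Vec ℕ n)) : Vec ℕ n → Vec ℕ n → Set where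
  gen   : ∀ {a b} → (a Data.Product., b) ∈ ρ → Cong ρ a b
  crefl : ∀ {a} → Cong ρ a a
  csym  : ∀ {a b} → Cong ρ a b → Cong ρ b a
  ctrans : ∀ {a b c} → Cong ρ a b → Cong ρ b c → Cong ρ a c
  cadd  : ∀ {a b} c → Cong ρ a b → Cong ρ (a ⊕ c) (b ⊕ c)

Generates : ∀ {n} → Vec ℕ n → List (Vec ℕ n × Vec ℕ n) → Set
Generates {n} r ρ =
  (∀ {a b} → (a Data.Product., b) ∈ ρ → φ r a ≡ φ r b) ×
  (∀ (a b : Vec ℕ n) → φ r a ≡ φ r b → Cong ρ a b)

_⊆_ : ∀ {A : Set} → List A → List A → Set
xs ⊆ ys = ∀ {x} → x ∈ xs → x ∈ ys

IsMinimalPresentation : ∀ {n} → Vec ℕ n → List (Vec ℕ n × Vec ℕ n) → Set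
IsMinimalPresentation r ρ =
  Unique ρ × Generates r ρ ×
  (∀ ρ' → ρ' ⊆ ρ → Generates r ρ' → ρ ⊆ ρ')

-- Complete intersection: some minimal presentation has cardinality e(Γ) - 1 = h
-- (here r has length h+1).
IsCompleteIntersection : ∀ {h} → Vec ℕ (suc h) → Set
IsCompleteIntersection {h} r =
  Σ (List (Vec ℕ (suc h) × Vec ℕ (suc h)))
    (λ ρ → IsMinimalPresentation r ρ × length ρ ≡ h)

-- Let m = r j₀ be the least generator and suppose some generator g = r k, k ≠ j₀, exceeds F. A set of
-- factorizations of one element that is closed under sharing a generator, and is neither empty nor everything,
-- is crossed by a relation of every presentation. For each i ≠ j₀ the factorization eₖ + eᵢ of g + rᵢ is such a
-- set on its own, while g + rᵢ − m > F yields a factorization through m; so ρ has a relation of each of the h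
-- distinct degrees g + rᵢ. One more relation sits at the least degree having factorizations both avoiding and
-- meeting Q, where Q = {j₀, k} if there is a third generator and Q = {k} otherwise. If that degree is some
-- g + rᵢ, the factorizations through m form a third class there, and no single relation crosses all three; with
-- two generators it cannot be 2g, since a factorization of 2g avoiding k would give m ∣ 2. So ρ has h + 1
-- relations, while a complete intersection has a minimal presentation with h.
module Submission where

open import Defs
open import Data.Nat using (ℕ; zero; suc; _+_; _*_; _∸_; _<_; _≤_; z≤n; s≤s; _≟_; _<?_; _≤?_)
open import Data.Nat.Properties
open import Data.Nat.Divisibility using (_∣_; _∣0; ∣⇒≤; ∣1⇒≡1; ∣m∣n⇒∣m+n; ∣m+n∣m⇒∣n; ∣n⇒∣m*n; n∣m*n)
open import Data.Nat.Induction using (<-rec)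
open import Data.Nat.Tactic.RingSolver using (solve-∀)
open import Data.Fin using (Fin; zero; suc; punchIn)
import Data.Fin.Properties as Fin
open import Data.Vec using (Vec; []; _∷_; lookup; replicate)
open import Data.Vec.Properties using (lookup-zipWith; lookup-replicate; zipWith-comm; zipWith-identityʳ; tabulate∘lookup; tabulate-cong; ≡-dec)
open import Data.List using (List; length)
open import Data.List.Membership.Propositional using (_∈_; find; lose)
open import Data.List.Relation.Unary.Any using (any?; index)
open import Data.List.Relation.Unary.Any.Properties using (lookup-index)
open import Data.Product using (∃-syntax; _×_; _,_; proj₁; proj₂)
open import Data.Sum using (_⊎_; inj₁; inj₂; [_,_])
open import Data.Empty using (⊥)
open import Function using (_∘_)
open import Function.Bundles using (_⇔_; mk⇔; Equivalence)
open import Function.Properties.Equivalence using (⇔-isEquivalence)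
open import Relation.Binary.Structures using (IsEquivalence)
open import Level using (0ℓ)
open import Relation.Binary.PropositionalEquality using (_≡_; _≢_; refl; sym; trans; cong; cong₂; subst; ≢-sym; module ≡-Reasoning)
open import Relation.Nullary using (¬_; Dec; yes; no; contradiction)
open import Relation.Nullary.Decidable using (_×-dec_; _⊎-dec_; _→-dec_; ¬?; decidable-stable)

module ⇔ = IsEquivalence (⇔-isEquivalence {ℓ = 0ℓ})

zeros : ∀ {n} → Vec ℕ n
zeros = replicate _ 0

single : ∀ {n} → ℕ → Fin n → Vec ℕ n
single c zero    = c ∷ zeros
single c (suc i) = 0 ∷ single c i

unit : ∀ {n} → Fin n → Vec ℕ n
unit = single 1

Pair : ℕ → Set
Pair n = Vec ℕ n × Vec ℕ n

Share : ∀ {n} → Vec ℕ n → Vec ℕ n → Set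
Share a b = ∃[ i ] 0 < lookup a i × 0 < lookup b i

Avoids : ∀ {n} → (Fin n → Set) → Vec ℕ n → Set
Avoids Q a = ∀ i → Q i → lookup a i ≡ 0

ShareClosed : ∀ {n} → Vec ℕ n → (Vec ℕ n → Set) → Set
ShareClosed r X = ∀ a b → φ r a ≡ φ r b → Share a b → X a → X b

Cross : ∀ {n} → (Vec ℕ n → Set) → Pair n → Set
Cross X (a , b) = (X a × ¬ X b) ⊎ (¬ X a × X b)

lookup-⊕ : ∀ {n} (a b : Vec ℕ n) i → lookup (a ⊕ b) i ≡ lookup a i + lookup b i
lookup-⊕ a b i = lookup-zipWith _+_ i a b

lookup-zeros : ∀ {n} (i : Fin n) → lookup zeros i ≡ 0
lookup-zeros i = lookup-replicate i 0

lookup-single-≡ : ∀ {n} c (i : Fin n) → lookup (single c i) i ≡ c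
lookup-single-≡ c zero    = refl
lookup-single-≡ c (suc i) = lookup-single-≡ c i

lookup-single-≢ : ∀ {n} c {i j : Fin n} → i ≢ j → lookup (single c i) j ≡ 0
lookup-single-≢ c {zero}  {zero}  i≢j = contradiction refl i≢j
lookup-single-≢ c {zero}  {suc j} _   = lookup-zeros j
lookup-single-≢ c {suc i} {zero}  _   = refl
lookup-single-≢ c {suc i} {suc j} i≢j = lookup-single-≢ c (i≢j ∘ cong suc)

unit-positive : ∀ {n} (i : Fin n) → 0 < lookup (unit i) i
unit-positive i = ≤-reflexive (sym (lookup-single-≡ 1 i))

⊕-positiveˡ : ∀ {n} {a : Vec ℕ n} b {i} → 0 < lookup a i → 0 < lookup (a ⊕ b) i
⊕-positiveˡ {a = a} b {i} a>0 = <-≤-trans a>0 (≤-trans (m≤m+n _ _) (≤-reflexive (sym (lookup-⊕ a b i))))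

⊕-positiveʳ : ∀ {n} a {b : Vec ℕ n} {i} → 0 < lookup b i → 0 < lookup (a ⊕ b) i
⊕-positiveʳ a {b} {i} b>0 = <-≤-trans b>0 (≤-trans (m≤n+m _ _) (≤-reflexive (sym (lookup-⊕ a b i))))

⊕-comm : ∀ {n} (a b : Vec ℕ n) → a ⊕ b ≡ b ⊕ a
⊕-comm = zipWith-comm +-comm

⊕-identityʳ : ∀ {n} (a : Vec ℕ n) → a ⊕ zeros ≡ a
⊕-identityʳ = zipWith-identityʳ +-identityʳ

lookup-extensionality : ∀ {n} {a b : Vec ℕ n} → (∀ i → lookup a i ≡ lookup b i) → a ≡ b
lookup-extensionality {a = a} {b} same =
  trans (sym (tabulate∘lookup a)) (trans (tabulate-cong same) (tabulate∘lookup b))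

zeros⊎positive-entry : ∀ {n} (a : Vec ℕ n) → a ≡ zeros ⊎ ∃[ i ] 0 < lookup a i
zeros⊎positive-entry []          = inj₁ refl
zeros⊎positive-entry (suc x ∷ a) = inj₂ (zero , s≤s z≤n)
zeros⊎positive-entry (zero ∷ a) with zeros⊎positive-entry a
... | inj₁ refl    = inj₁ refl
... | inj₂ (i , p) = inj₂ (suc i , p)

split-unit : ∀ {n} (a : Vec ℕ n) i → 0 < lookup a i → ∃[ a′ ] a ≡ unit i ⊕ a′
split-unit (suc x ∷ a) zero    _   = x ∷ a , cong (suc x ∷_) (sym (trans (⊕-comm zeros a) (⊕-identityʳ a)))
split-unit (x ∷ a)     (suc i) a>0 with split-unit a i a>0
... | a′ , refl = x ∷ a′ , refl

support-unit-⊕-unit : ∀ {n} (i j : Fin n) {t} → 0 < lookup (unit i ⊕ unit j) t → t ≡ i ⊎ t ≡ j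
support-unit-⊕-unit i j {t} t>0 with t Fin.≟ i | t Fin.≟ j
... | yes t≡i | _       = inj₁ t≡i
... | no _    | yes t≡j = inj₂ t≡j
... | no t≢i  | no t≢j  = contradiction
  (trans (lookup-⊕ (unit i) (unit j) t) (cong₂ _+_ (lookup-single-≢ 1 (t≢i ∘ sym)) (lookup-single-≢ 1 (t≢j ∘ sym))))
  (≢-sym (<⇒≢ t>0))

avoids? : ∀ {n} {Q : Fin n → Set} → (∀ i → Dec (Q i)) → ∀ a → Dec (Avoids Q a)
avoids? Q? a = Fin.all? (λ i → Q? i →-dec (lookup a i ≟ 0))

avoids-⊕ : ∀ {n} {Q : Fin n → Set} (a b : Vec ℕ n) → Avoids Q (a ⊕ b) ⇔ (Avoids Q a × Avoids Q b)
avoids-⊕ a b = mk⇔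
  (λ avoids → (λ i q → m+n≡0⇒m≡0 _ (trans (sym (lookup-⊕ a b i)) (avoids i q)))
            , (λ i q → m+n≡0⇒n≡0 _ (trans (sym (lookup-⊕ a b i)) (avoids i q))))
  (λ (avoids-a , avoids-b) i q → trans (lookup-⊕ a b i) (cong₂ _+_ (avoids-a i q) (avoids-b i q)))

single-avoids : ∀ {n} {Q : Fin n → Set} c {i} → ¬ Q i → Avoids Q (single c i)
single-avoids c {i} ¬Qi j Qj = lookup-single-≢ c {i} {j} (λ { refl → ¬Qi Qj })

single-not-avoiding : ∀ {n} {Q : Fin n → Set} {c i} → Q i → 0 < c → ¬ Avoids Q (single c i)
single-not-avoiding {c = c} {i} Qi c>0 avoids = <⇒≢ c>0 (trans (sym (avoids i Qi)) (lookup-single-≡ c i))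

avoids⇒¬positive : ∀ {n} {Q : Fin n → Set} {a : Vec ℕ n} {i} → Avoids Q a → Q i → ¬ 0 < lookup a i
avoids⇒¬positive {i = i} avoids Qi a>0 = <⇒≢ a>0 (sym (avoids i Qi))

φ-⊕ : ∀ {n} (r a b : Vec ℕ n) → φ r (a ⊕ b) ≡ φ r a + φ r b
φ-⊕ []      []      []      = refl
φ-⊕ (x ∷ r) (y ∷ a) (z ∷ b) = trans (cong ((y + z) * x +_) (φ-⊕ r a b)) (regroup y z x (φ r a) (φ r b))
  where
  regroup : ∀ y z x A B → (y + z) * x + (A + B) ≡ (y * x + A) + (z * x + B)
  regroup = solve-∀

φ-zeros : ∀ {n} (r : Vec ℕ n) → φ r zeros ≡ 0
φ-zeros []      = refl
φ-zeros (x ∷ r) = φ-zeros r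

φ-single : ∀ {n} (r : Vec ℕ n) c i → φ r (single c i) ≡ c * lookup r i
φ-single (x ∷ r) c zero    = trans (cong (c * x +_) (φ-zeros r)) (+-identityʳ _)
φ-single (x ∷ r) c (suc i) = φ-single r c i

φ-unit : ∀ {n} (r : Vec ℕ n) i → φ r (unit i) ≡ lookup r i
φ-unit r i = trans (φ-single r 1 i) (*-identityˡ _)

φ-unit-⊕ : ∀ {n} (r : Vec ℕ n) i a → φ r (unit i ⊕ a) ≡ lookup r i + φ r a
φ-unit-⊕ r i a = trans (φ-⊕ r (unit i) a) (cong (_+ φ r a) (φ-unit r i))

lookup≤φ : ∀ {n} (r a : Vec ℕ n) {i} → 0 < lookup a i → lookup r i ≤ φ r a
lookup≤φ r a {i} a>0 with split-unit a i a>0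
... | a′ , refl = ≤-trans (m≤m+n _ _) (≤-reflexive (sym (φ-unit-⊕ r i a′)))

φ-concentrated : ∀ {n} (r a : Vec ℕ n) j → (∀ i → i ≢ j → lookup a i ≡ 0) → φ r a ≡ lookup a j * lookup r j
φ-concentrated r a j vanishes = trans (cong (φ r) a≡single) (φ-single r (lookup a j) j)
  where
  a≡single : a ≡ single (lookup a j) j
  a≡single = lookup-extensionality λ i → case i
    where
    case : ∀ i → lookup a i ≡ lookup (single (lookup a j) j) i
    case i with i Fin.≟ j
    ... | yes refl = sym (lookup-single-≡ _ i)
    ... | no i≢j   = trans (vanishes i i≢j) (sym (lookup-single-≢ _ (i≢j ∘ sym)))

∣-scaled-φ : ∀ {n d} c (r a : Vec ℕ n) → (∀ i → d ∣ c * lookup r i) → d ∣ c * φ r a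
∣-scaled-φ {d = d} c []      []      _     = subst (d ∣_) (sym (*-zeroʳ c)) (d ∣0)
∣-scaled-φ {d = d} c (x ∷ r) (y ∷ a) d∣cr =
  subst (d ∣_) (sym (distrib c y x (φ r a)))
    (∣m∣n⇒∣m+n (∣n⇒∣m*n y (d∣cr zero)) (∣-scaled-φ c r a (d∣cr ∘ suc)))
  where
  distrib : ∀ c y x A → c * (y * x + A) ≡ y * (c * x) + c * A
  distrib = solve-∀

-- Two consecutive integers N, N + 1 lie in Γ, so d divides c (N + 1) − c N.
∣-scaled-generators⇒∣ : ∀ {n d} {r : Vec ℕ n} c → IsNumericalSemigroup r → (∀ i → d ∣ c * lookup r i) → d ∣ c
∣-scaled-generators⇒∣ {d = d} {r} c (N , large) d∣cr =
  ∣m+n∣m⇒∣n (subst (d ∣_) (trans (*-suc c N) (+-comm c (c * N))) (∣-in-Γ (suc N) (n≤1+n N))) (∣-in-Γ N ≤-refl)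
  where
  ∣-in-Γ : ∀ x → N ≤ x → d ∣ c * x
  ∣-in-Γ x N≤x with large x N≤x
  ... | a , refl = ∣-scaled-φ c r a d∣cr

n>0⇒n≢1⇒n≢2⇒3≤n : ∀ {n} → 0 < n → n ≢ 1 → n ≢ 2 → 3 ≤ n
n>0⇒n≢1⇒n≢2⇒3≤n {1}                   _ n≢1 _   = contradiction refl n≢1
n>0⇒n≢1⇒n≢2⇒3≤n {2}                   _ _   n≢2 = contradiction refl n≢2
n>0⇒n≢1⇒n≢2⇒3≤n {suc (suc (suc _))} _ _   _   = s≤s (s≤s (s≤s z≤n))

least-index : ∀ {h} (v : Vec ℕ (suc h)) → ∃[ j ] (∀ i → lookup v j ≤ lookup v i)
least-index {zero}  (x ∷ []) = zero , λ { zero → ≤-refl }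
least-index {suc h} (x ∷ v) with least-index v
... | j , least with x ≤? lookup v j
... | yes x≤ = zero , λ { zero → ≤-refl ; (suc i) → ≤-trans x≤ (least i) }
... | no x≰  = suc j , λ { zero → <⇒≤ (≰⇒> x≰) ; (suc i) → least i }

injection-into-list : ∀ {A : Set} {n} (xs : List A) (f : Fin n → A) →
  (∀ i → f i ∈ xs) → (∀ {i j} → f i ≡ f j → i ≡ j) → n ≤ length xs
injection-into-list {n = n} xs f f∈xs f-injective with length xs <? n
... | no ≮n = ≮⇒≥ ≮n
... | yes <n with Fin.pigeonhole <n (index ∘ f∈xs)
...   | i , j , i<j , same-index = contradiction
  (f-injective (trans (lookup-index (f∈xs i)) (trans (cong (Data.List.lookup xs) same-index) (sym (lookup-index (f∈xs j))))))
  (Fin.<⇒≢ i<j)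

module MinimalGenerators {n} (r : Vec ℕ n) (mg : IsMinimalGenerating r) where

  generator-positive : ∀ i → 0 < lookup r i
  generator-positive i with lookup r i in eq
  ... | suc _ = s≤s z≤n
  ... | zero  = contradiction (zeros , lookup-zeros i , trans (φ-zeros r) (sym eq)) (proj₂ mg i)

  φ≡0⇒zeros : ∀ a → φ r a ≡ 0 → a ≡ zeros
  φ≡0⇒zeros a φa≡0 with zeros⊎positive-entry a
  ... | inj₁ a≡0         = a≡0
  ... | inj₂ (i , a>0) = contradiction φa≡0 (≢-sym (<⇒≢ (<-≤-trans (generator-positive i) (lookup≤φ r a a>0))))

  factorization-of-generator : ∀ {a} i → φ r a ≡ lookup r i → a ≡ unit i
  factorization-of-generator {a} i φa≡ri with lookup a i in eq
  ... | zero  = contradiction (a , eq , φa≡ri) (proj₂ mg i)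
  ... | suc _ with split-unit a i (subst (0 <_) (sym eq) (s≤s z≤n))
  ...   | a′ , refl = trans (cong (unit i ⊕_) (φ≡0⇒zeros a′ φa′≡0)) (⊕-identityʳ (unit i))
    where
    φa′≡0 : φ r a′ ≡ 0
    φa′≡0 = +-cancelˡ-≡ (lookup r i) _ _ (trans (sym (φ-unit-⊕ r i a′)) (trans φa≡ri (sym (+-identityʳ _))))

  factorization-of-two-generators : ∀ {a} i j → 0 < lookup a i → φ r a ≡ lookup r i + lookup r j → a ≡ unit i ⊕ unit j
  factorization-of-two-generators {a} i j a>0 φa≡ with split-unit a i a>0
  ... | a′ , refl = cong (unit i ⊕_) (factorization-of-generator j (+-cancelˡ-≡ (lookup r i) _ _ (trans (sym (φ-unit-⊕ r i a′)) φa≡)))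

  least-generator-is-multiplicity : ∀ j → (∀ i → lookup r j ≤ lookup r i) → IsMultiplicity r (lookup r j)
  least-generator-is-multiplicity j least = (unit j , φ-unit r j) , generator-positive j , above
    where
    above : ∀ x → InΓ r x → 0 < x → lookup r j ≤ x
    above _ (a , refl) φa>0 with zeros⊎positive-entry a
    ... | inj₁ refl        = contradiction (φ-zeros r) (≢-sym (<⇒≢ φa>0))
    ... | inj₂ (i , a>0) = ≤-trans (least i) (lookup≤φ r a a>0)

  module _ {Q : Fin n → Set} (Q? : ∀ i → Dec (Q i)) where

    AvoidingAt : ℕ → Vec ℕ n → Set
    AvoidingAt s a = φ r a ≡ s × Avoids Q a

    Mixed : ℕ → Set
    Mixed s = ∃[ a ] ∃[ b ] AvoidingAt s a × φ r b ≡ s × ¬ Avoids Q b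

    -- Cancelling a shared generator from a mixed pair gives a mixed pair of smaller degree.
    avoiding-closed-below-mixed : ∀ {s} → (∀ {s′} → s′ < s → ¬ Mixed s′) → ShareClosed r (AvoidingAt s)
    avoiding-closed-below-mixed {s} unmixed a b φa≡φb (t , a>0 , b>0) (φa≡s , a-avoids)
      with split-unit a t a>0 | split-unit b t b>0
    ... | a′ , refl | b′ , refl = trans (sym φa≡φb) φa≡s , decidable-stable (avoids? Q? (unit t ⊕ b′)) b-avoids
      where
      ¬Qt : ¬ Q t
      ¬Qt Qt = avoids⇒¬positive {a = unit t ⊕ a′} a-avoids Qt a>0
      φa′≡φb′ : φ r a′ ≡ φ r b′
      φa′≡φb′ = +-cancelˡ-≡ (lookup r t) _ _ (trans (sym (φ-unit-⊕ r t a′)) (trans φa≡φb (φ-unit-⊕ r t b′)))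
      φa′<s : φ r a′ < s
      φa′<s = subst (φ r a′ <_) (trans (sym (φ-unit-⊕ r t a′)) φa≡s) (m<n+m _ (generator-positive t))
      b-avoids : ¬ ¬ Avoids Q (unit t ⊕ b′)
      b-avoids ¬avoids = unmixed φa′<s
        ( a′ , b′ , (refl , proj₂ (Equivalence.to (avoids-⊕ {Q = Q} (unit t) a′) a-avoids)) , sym φa′≡φb′
        , λ b′-avoids → ¬avoids (Equivalence.from (avoids-⊕ {Q = Q} (unit t) b′) (single-avoids 1 ¬Qt , b′-avoids)))

module Presentation {n} (r : Vec ℕ n) (ρ : List (Pair n)) (gens : Generates r ρ) where

  deg : Pair n → ℕ
  deg (a , _) = φ r a

  Cong⇒φ≡ : ∀ {a b} → Cong ρ a b → φ r a ≡ φ r b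
  Cong⇒φ≡ (gen a,b∈ρ)   = proj₁ gens a,b∈ρ
  Cong⇒φ≡ crefl         = refl
  Cong⇒φ≡ (csym a~b)    = sym (Cong⇒φ≡ a~b)
  Cong⇒φ≡ (ctrans a~b b~c) = trans (Cong⇒φ≡ a~b) (Cong⇒φ≡ b~c)
  Cong⇒φ≡ (cadd {a} {b} c a~b) = begin
    φ r (a ⊕ c)     ≡⟨ φ-⊕ r a c ⟩
    φ r a + φ r c   ≡⟨ cong (_+ φ r c) (Cong⇒φ≡ a~b) ⟩
    φ r b + φ r c   ≡⟨ φ-⊕ r b c ⟨
    φ r (b ⊕ c)     ∎
    where open ≡-Reasoning

  deg-crossing : ∀ (X : Vec ℕ n → Set) {s x} → (∀ {a} → X a → φ r a ≡ s) → x ∈ ρ → Cross X x → deg x ≡ s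
  deg-crossing X X⊆s x∈ρ (inj₁ (Xa , _)) = X⊆s Xa
  deg-crossing X X⊆s x∈ρ (inj₂ (_ , Xb)) = trans (proj₁ gens x∈ρ) (X⊆s Xb)

  cross-three-disjoint : ∀ {A B C : Vec ℕ n → Set} {x} →
    (∀ {a} → A a → ¬ B a) → (∀ {a} → A a → ¬ C a) → (∀ {a} → B a → ¬ C a) →
    Cross A x → Cross B x → ¬ Cross C x
  cross-three-disjoint A∩B A∩C B∩C (inj₁ (Aa , _)) (inj₁ (Ba , _)) _ = A∩B Aa Ba
  cross-three-disjoint A∩B A∩C B∩C (inj₁ (Aa , _)) (inj₂ (_ , Bb)) (inj₁ (Ca , _)) = A∩C Aa Ca
  cross-three-disjoint A∩B A∩C B∩C (inj₁ (Aa , _)) (inj₂ (_ , Bb)) (inj₂ (_ , Cb)) = B∩C Bb Cb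
  cross-three-disjoint A∩B A∩C B∩C (inj₂ (_ , Ab)) (inj₁ (Ba , _)) (inj₁ (Ca , _)) = B∩C Ba Ca
  cross-three-disjoint A∩B A∩C B∩C (inj₂ (_ , Ab)) (inj₁ (Ba , _)) (inj₂ (_ , Cb)) = A∩C Ab Cb
  cross-three-disjoint A∩B A∩C B∩C (inj₂ (_ , Ab)) (inj₂ (_ , Bb)) _ = A∩B Ab Bb

  module _ {X : Vec ℕ n → Set} (X? : ∀ a → Dec (X a)) where

    cross? : ∀ x → Dec (Cross X x)
    cross? (a , b) = (X? a ×-dec ¬? (X? b)) ⊎-dec (¬? (X? a) ×-dec X? b)

    uncrossed-invariant : ShareClosed r X → (∀ {x} → x ∈ ρ → ¬ Cross X x) → ∀ {a b} → Cong ρ a b → X a ⇔ X b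
    uncrossed-invariant closed uncrossed (gen {a} {b} a,b∈ρ) = mk⇔
      (λ Xa → decidable-stable (X? b) (λ ¬Xb → uncrossed a,b∈ρ (inj₁ (Xa , ¬Xb))))
      (λ Xb → decidable-stable (X? a) (λ ¬Xa → uncrossed a,b∈ρ (inj₂ (¬Xa , Xb))))
    uncrossed-invariant closed uncrossed crefl = ⇔.refl
    uncrossed-invariant closed uncrossed (csym a~b) = ⇔.sym (uncrossed-invariant closed uncrossed a~b)
    uncrossed-invariant closed uncrossed (ctrans a~b b~c) =
      ⇔.trans (uncrossed-invariant closed uncrossed a~b) (uncrossed-invariant closed uncrossed b~c)
    uncrossed-invariant closed uncrossed (cadd {a} {b} c a~b) with zeros⊎positive-entry c
    ... | inj₁ refl rewrite ⊕-identityʳ a | ⊕-identityʳ b = uncrossed-invariant closed uncrossed a~b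
    ... | inj₂ (i , c>0) = mk⇔
      (closed (a ⊕ c) (b ⊕ c) φ≡ (i , ⊕-positiveʳ a c>0 , ⊕-positiveʳ b c>0))
      (closed (b ⊕ c) (a ⊕ c) (sym φ≡) (i , ⊕-positiveʳ b c>0 , ⊕-positiveʳ a c>0))
      where
      φ≡ : φ r (a ⊕ c) ≡ φ r (b ⊕ c)
      φ≡ = Cong⇒φ≡ (cadd c a~b)

    crossing-relation : ShareClosed r X → ∀ a b → X a → ¬ X b → φ r a ≡ φ r b → ∃[ x ] x ∈ ρ × Cross X x
    crossing-relation closed a b Xa ¬Xb φa≡φb with any? cross? ρ
    ... | yes crossed = find crossed
    ... | no uncrossed = contradiction
      (Equivalence.to (uncrossed-invariant closed (λ x∈ρ → uncrossed ∘ lose x∈ρ) (proj₂ gens a b φa≡φb)) Xa) ¬Xb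

module LargeGenerator
  {h} (r : Vec ℕ (suc h)) (mg : IsMinimalGenerating r)
  (ρ : List (Pair (suc h))) (gens : Generates r ρ) (|ρ|≡h : length ρ ≡ h)
  (j₀ k : Fin (suc h)) (j₀≢k : j₀ ≢ k) (j₀-least : ∀ i → lookup r j₀ ≤ lookup r i)
  (f : ℕ) (above-f : ∀ x → f < x → InΓ r x) (f<g : f < lookup r k)
  where

  open MinimalGenerators r mg
  open Presentation r ρ gens

  m g : ℕ
  m = lookup r j₀
  g = lookup r k

  other : Fin h → Fin (suc h)
  other = punchIn j₀

  level : Fin h → ℕ
  level i = g + lookup r (other i)

  level-injective : ∀ {i j} → level i ≡ level j → i ≡ j
  level-injective eq = Fin.punchIn-injective j₀ _ _ (proj₁ mg _ _ (+-cancelˡ-≡ g _ _ eq))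

  viaK : Fin h → Vec ℕ (suc h)
  viaK i = unit k ⊕ unit (other i)

  φ-viaK : ∀ i → φ r (viaK i) ≡ level i
  φ-viaK i = trans (φ-unit-⊕ r k _) (cong (g +_) (φ-unit r (other i)))

  viaK-j₀ : ∀ i → lookup (viaK i) j₀ ≡ 0
  viaK-j₀ i = trans (lookup-⊕ (unit k) _ j₀)
    (cong₂ _+_ (lookup-single-≢ 1 (j₀≢k ∘ sym)) (lookup-single-≢ 1 (Fin.punchInᵢ≢i j₀ i)))

  viaK-closed : ∀ i → ShareClosed r (_≡ viaK i)
  viaK-closed i _ b φ≡ (t , t∈viaK , b>0) refl with support-unit-⊕-unit k (other i) t∈viaK
  ... | inj₁ refl = factorization-of-two-generators k (other i) b>0 (trans (sym φ≡) (φ-viaK i))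
  ... | inj₂ refl = trans
    (factorization-of-two-generators (other i) k b>0 (trans (sym φ≡) (trans (φ-viaK i) (+-comm g _))))
    (⊕-comm _ _)

  viaJ₀ : ∀ i → ∃[ b ] φ r b ≡ level i × 0 < lookup b j₀
  viaJ₀ i = unit j₀ ⊕ c , φb≡level , ⊕-positiveˡ {a = unit j₀} c (unit-positive j₀)
    where
    m≤ri : m ≤ lookup r (other i)
    m≤ri = j₀-least (other i)
    level∸m∈Γ : InΓ r (level i ∸ m)
    level∸m∈Γ = above-f _ (<-≤-trans f<g (≤-trans (m≤m+n g _) (≤-reflexive (sym (+-∸-assoc g m≤ri)))))
    c : Vec ℕ (suc h)
    c = proj₁ level∸m∈Γ
    φb≡level : φ r (unit j₀ ⊕ c) ≡ level i
    φb≡level = begin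
      φ r (unit j₀ ⊕ c)  ≡⟨ φ-unit-⊕ r j₀ c ⟩
      m + φ r c          ≡⟨ cong (m +_) (proj₂ level∸m∈Γ) ⟩
      m + (level i ∸ m)  ≡⟨ m+[n∸m]≡n (≤-trans m≤ri (m≤n+m _ g)) ⟩
      level i            ∎
      where open ≡-Reasoning

  relationAt : ∀ i → ∃[ x ] x ∈ ρ × Cross (_≡ viaK i) x
  relationAt i with viaJ₀ i
  ... | b , φb≡level , b>0 = crossing-relation (λ a → ≡-dec _≟_ a (viaK i)) (viaK-closed i) (viaK i) b
    refl (λ { refl → <⇒≢ b>0 (sym (viaK-j₀ i)) }) (trans (φ-viaK i) (sym φb≡level))

  relation : Fin h → Pair (suc h)
  relation i = proj₁ (relationAt i)

  relation∈ρ : ∀ i → relation i ∈ ρ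
  relation∈ρ i = proj₁ (proj₂ (relationAt i))

  relation-crosses : ∀ i → Cross (_≡ viaK i) (relation i)
  relation-crosses i = proj₂ (proj₂ (relationAt i))

  deg-relation : ∀ i → deg (relation i) ≡ level i
  deg-relation i = deg-crossing (_≡ viaK i) (λ { refl → φ-viaK i }) (relation∈ρ i) (relation-crosses i)

  relation-injective : ∀ {i j} → relation i ≡ relation j → i ≡ j
  relation-injective {i} {j} eq = level-injective (trans (sym (deg-relation i)) (trans (cong deg eq) (deg-relation j)))

  ≢-other-relations : ∀ {y} i* → deg y ≡ level i* → y ≢ relation i* → ∀ i → y ≢ relation i
  ≢-other-relations {y} i* deg-y y≢ i y≡ = y≢ (subst (λ j → y ≡ relation j)
    (level-injective (trans (sym (deg-relation i)) (trans (cong deg (sym y≡)) deg-y))) y≡)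

  new-relation-impossible : ∀ {x} → x ∈ ρ → (∀ i → x ≢ relation i) → ⊥
  new-relation-impossible {x} x∈ρ new =
    1+n≰n (subst (suc h ≤_) |ρ|≡h (injection-into-list ρ extended extended∈ρ extended-injective))
    where
    extended : Fin (suc h) → Pair (suc h)
    extended zero    = x
    extended (suc i) = relation i
    extended∈ρ : ∀ i → extended i ∈ ρ
    extended∈ρ zero    = x∈ρ
    extended∈ρ (suc i) = relation∈ρ i
    extended-injective : ∀ {i j} → extended i ≡ extended j → i ≡ j
    extended-injective {zero}  {zero}  _  = refl
    extended-injective {zero}  {suc j} eq = contradiction eq (new j)
    extended-injective {suc i} {zero}  eq = contradiction (sym eq) (new i)
    extended-injective {suc i} {suc j} eq = cong suc (relation-injective eq)

  module _ {Q : Fin (suc h) → Set} (Q? : ∀ i → Dec (Q i)) (Qk : Q k) where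

    viaK-not-avoiding : ∀ i → ¬ Avoids Q (viaK i)
    viaK-not-avoiding i avoids = avoids⇒¬positive {a = viaK i} avoids Qk (⊕-positiveˡ {a = unit k} (unit (other i)) (unit-positive k))

    avoidingAt? : ∀ s a → Dec (AvoidingAt Q? s a)
    avoidingAt? s a = (φ r a ≟ s) ×-dec avoids? Q? a

    new-relation-off-levels : ∀ {s a b} → AvoidingAt Q? s a → φ r b ≡ s → ¬ Avoids Q b →
      ShareClosed r (AvoidingAt Q? s) → (∀ i → s ≢ level i) → ∃[ x ] x ∈ ρ × (∀ i → x ≢ relation i)
    new-relation-off-levels {s} {a} {b} a-avoiding φb≡s ¬b-avoids closed off-levels
      with crossing-relation {X = AvoidingAt Q? s} (avoidingAt? s) closed a b
             a-avoiding (¬b-avoids ∘ proj₂) (trans (proj₁ a-avoiding) (sym φb≡s))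
    ... | x , x∈ρ , crosses = x , x∈ρ , λ i x≡ →
      off-levels i (trans (sym (deg-crossing (AvoidingAt Q? s) proj₁ x∈ρ crosses)) (trans (cong deg x≡) (deg-relation i)))

    -- At degree level i* three share-closed sets of factorizations are nonempty: {viaK i*}, those avoiding Q,
    -- and the rest (containing viaJ₀ i* because Q j₀); one relation cannot cross all three.
    new-relation-at-level : ∀ {s a} i* → s ≡ level i* → Q j₀ → AvoidingAt Q? s a →
      ShareClosed r (AvoidingAt Q? s) → ∃[ x ] x ∈ ρ × (∀ i → x ≢ relation i)
    new-relation-at-level {s} {a} i* refl Qj₀ a-avoiding closed with cross? (avoidingAt? s) (relation i*)
    ... | yes crossesB =
      let y , y∈ρ , crossesC = crossing-relation {X = Rest} Rest? Rest-closed b (viaK i*)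
                                 b-rest (λ (_ , ¬A , _) → ¬A refl) (trans φb≡s (sym (φ-viaK i*)))
      in y , y∈ρ , ≢-other-relations i* (deg-crossing Rest proj₁ y∈ρ crossesC) λ y≡ →
        cross-three-disjoint {A = _≡ viaK i*} {B = AvoidingAt Q? s} {C = Rest}
          (λ { refl → viaK-not-avoiding i* ∘ proj₂ }) (λ { refl (_ , ¬A , _) → ¬A refl }) (λ B (_ , _ , ¬B) → ¬B B)
          (relation-crosses i*) crossesB (subst (Cross Rest) y≡ crossesC)
      where
      b : Vec ℕ (suc h)
      b = proj₁ (viaJ₀ i*)
      φb≡s : φ r b ≡ s
      φb≡s = proj₁ (proj₂ (viaJ₀ i*))
      b>0 : 0 < lookup b j₀
      b>0 = proj₂ (proj₂ (viaJ₀ i*))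
      Rest : Vec ℕ (suc h) → Set
      Rest c = φ r c ≡ s × ¬ c ≡ viaK i* × ¬ AvoidingAt Q? s c
      Rest? : ∀ c → Dec (Rest c)
      Rest? c = (φ r c ≟ s) ×-dec ¬? (≡-dec _≟_ c (viaK i*)) ×-dec ¬? (avoidingAt? s c)
      Rest-closed : ShareClosed r Rest
      Rest-closed c d φ≡ (t , c>0 , d>0) (φc≡s , ¬A , ¬B) =
        trans (sym φ≡) φc≡s , ¬A ∘ viaK-closed i* d c (sym φ≡) (t , d>0 , c>0) , ¬B ∘ closed d c (sym φ≡) (t , d>0 , c>0)
      b-rest : Rest b
      b-rest = φb≡s , (λ b≡viaK → <⇒≢ b>0 (sym (trans (cong (λ c → lookup c j₀) b≡viaK) (viaK-j₀ i*))))
             , λ (_ , b-avoids) → avoids⇒¬positive {a = b} b-avoids Qj₀ b>0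
    ... | no ¬crossesB =
      let y , y∈ρ , crossesB = crossing-relation {X = AvoidingAt Q? s} (avoidingAt? s) closed a (viaK i*)
                                 a-avoiding (viaK-not-avoiding i* ∘ proj₂) (trans (proj₁ a-avoiding) (sym (φ-viaK i*)))
      in y , y∈ρ , ≢-other-relations i* (deg-crossing (AvoidingAt Q? s) proj₁ y∈ρ crossesB)
                     λ y≡ → ¬crossesB (subst (Cross (AvoidingAt Q? s)) y≡ crossesB)

    new-relation : ∀ {s a b} → AvoidingAt Q? s a → φ r b ≡ s → ¬ Avoids Q b → ShareClosed r (AvoidingAt Q? s) →
      (∀ i → s ≡ level i → Q j₀) → ∃[ x ] x ∈ ρ × (∀ i → x ≢ relation i)
    new-relation {s} {a} {b} a-avoiding φb≡s ¬b-avoids closed collision with Fin.any? (λ i → s ≟ level i)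
    ... | yes (i* , s≡level) = new-relation-at-level {a = a} i* s≡level (collision i* s≡level) a-avoiding closed
    ... | no off-levels      = new-relation-off-levels {a = a} {b} a-avoiding φb≡s ¬b-avoids closed (λ i s≡ → off-levels (i , s≡))

    mixed-impossible : (∀ s a → AvoidingAt Q? s a → ∀ i → s ≡ level i → Q j₀) → ∀ s → ¬ Mixed Q? s
    mixed-impossible collision = <-rec (λ s → ¬ Mixed Q? s) λ s unmixed (a , b , a-avoiding , φb≡s , ¬b-avoids) →
      let x , x∈ρ , new = new-relation {a = a} {b} a-avoiding φb≡s ¬b-avoids (avoiding-closed-below-mixed Q? unmixed)
                            (collision s a a-avoiding)
      in new-relation-impossible x∈ρ new

  third-generator-impossible : ∀ i₁ → i₁ ≢ j₀ → i₁ ≢ k → ⊥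
  third-generator-impossible i₁ i₁≢j₀ i₁≢k =
    mixed-impossible Q? (inj₂ refl) (λ _ _ _ _ _ → inj₁ refl) (m * lookup r i₁)
      ( single m i₁ , single (lookup r i₁) j₀
      , (φ-single r m i₁ , single-avoids m [ i₁≢j₀ , i₁≢k ])
      , trans (φ-single r _ j₀) (*-comm _ m)
      , single-not-avoiding (inj₁ refl) (generator-positive i₁) )
    where
    Q : Fin (suc h) → Set
    Q i = i ≡ j₀ ⊎ i ≡ k
    Q? : ∀ i → Dec (Q i)
    Q? i = (i Fin.≟ j₀) ⊎-dec (i Fin.≟ k)

  two-generators-impossible : IsNumericalSemigroup r → 3 ≤ m → (∀ i → i ≢ j₀ → i ≡ k) → ⊥
  two-generators-impossible ns 3≤m only-k =
    mixed-impossible Q? refl collision (g * m)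
      ( single g j₀ , single m k
      , (φ-single r g j₀ , single-avoids g j₀≢k)
      , trans (φ-single r m k) (*-comm m g)
      , single-not-avoiding refl (generator-positive j₀) )
    where
    Q : Fin (suc h) → Set
    Q = _≡ k
    Q? : ∀ i → Dec (Q i)
    Q? i = i Fin.≟ k
    -- Here level i = 2g, and a factorization avoiding k is a multiple of m, so m ∣ 2g and hence m ∣ 2.
    collision : ∀ s a → AvoidingAt Q? s a → ∀ i → s ≡ level i → Q j₀
    collision s a (φa≡s , a-avoids) i s≡level = contradiction 3≤m (≤⇒≯ (∣⇒≤ m∣2))
      where
      2g≡ : 2 * g ≡ lookup a j₀ * m
      2g≡ = begin
        2 * g            ≡⟨ cong (g +_) (+-identityʳ g) ⟩
        g + g            ≡⟨ cong (λ t → g + lookup r t) (sym (only-k (other i) (Fin.punchInᵢ≢i j₀ i))) ⟩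
        level i          ≡⟨ sym s≡level ⟩
        s                ≡⟨ sym φa≡s ⟩
        φ r a            ≡⟨ φ-concentrated r a j₀ (λ t t≢j₀ → a-avoids t (only-k t t≢j₀)) ⟩
        lookup a j₀ * m  ∎
        where open ≡-Reasoning
      m∣2r : ∀ t → m ∣ 2 * lookup r t
      m∣2r t with t Fin.≟ j₀
      ... | yes refl = n∣m*n 2
      ... | no t≢j₀ rewrite only-k t t≢j₀ = subst (m ∣_) (sym 2g≡) (n∣m*n (lookup a j₀))
      m∣2 : m ∣ 2
      m∣2 = ∣-scaled-generators⇒∣ 2 ns m∣2r

  impossible : IsNumericalSemigroup r → 3 ≤ m → ⊥
  impossible ns 3≤m with Fin.any? (λ i → ¬? (i Fin.≟ j₀) ×-dec ¬? (i Fin.≟ k))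
  ... | yes (i , i≢j₀ , i≢k) = third-generator-impossible i i≢j₀ i≢k
  ... | no none = two-generators-impossible ns 3≤m
    (λ i i≢j₀ → decidable-stable (i Fin.≟ k) (λ i≢k → none (i , i≢j₀ , i≢k)))

-- If every generator were r j₀ then Γ = (r j₀) ℕ, which is numerical only for r j₀ = 1.
large-generator-besides-least : ∀ {h} (r : Vec ℕ (suc h)) → IsNumericalSemigroup r → ∀ j₀ → lookup r j₀ ≢ 1 →
  (∀ i → lookup r j₀ ≤ lookup r i) → ∀ {f} k → f < lookup r k → ∃[ k′ ] j₀ ≢ k′ × f < lookup r k′
large-generator-besides-least r ns j₀ m≢1 j₀-least k f<rk with k Fin.≟ j₀
... | no k≢j₀   = k , k≢j₀ ∘ sym , f<rk
... | yes k≡j₀ with Fin.any? (λ i → ¬? (i Fin.≟ j₀))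
...   | yes (i , i≢j₀) = i , i≢j₀ ∘ sym , <-≤-trans (subst (λ t → _ < lookup r t) k≡j₀ f<rk) (j₀-least i)
...   | no only-j₀     = contradiction (∣1⇒≡1 (∣-scaled-generators⇒∣ 1 ns m∣r)) m≢1
  where
  m∣r : ∀ t → lookup r j₀ ∣ 1 * lookup r t
  m∣r t rewrite decidable-stable (t Fin.≟ j₀) (λ t≢j₀ → only-j₀ (t , t≢j₀)) = n∣m*n 1

proposition2p11 : (h : ℕ) (r : Vec ℕ (suc h))
    → IsNumericalSemigroup r
    → IsMinimalGenerating r
    → IsCompleteIntersection r
    → (∃[ x ] ¬ InΓ r x)
    → (∀ m → IsMultiplicity r m → m ≢ 2)
    → ∀ f → IsFrobenius r f → ∀ (k : Fin (suc h)) → lookup r k < f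
proposition2p11 h r ns mg (ρ , (_ , gens , _) , |ρ|≡h) (x₀ , x₀∉Γ) multiplicity≢2 f (f∉Γ , above-f) k =
  decidable-stable (lookup r k <? f) λ rk≮f →
    let k′ , j₀≢k′ , f<rk′ = large-generator-besides-least r ns j₀ m≢1 j₀-least k (f<rk rk≮f)
    in LargeGenerator.impossible r mg ρ gens |ρ|≡h j₀ k′ j₀≢k′ j₀-least f above-f f<rk′ ns 3≤m
  where
  open MinimalGenerators r mg
  j₀ : Fin (suc h)
  j₀ = proj₁ (least-index r)
  j₀-least : ∀ i → lookup r j₀ ≤ lookup r i
  j₀-least = proj₂ (least-index r)
  m≢1 : lookup r j₀ ≢ 1
  m≢1 m≡1 = x₀∉Γ (single x₀ j₀ , trans (φ-single r x₀ j₀) (trans (cong (x₀ *_) m≡1) (*-identityʳ x₀)))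
  3≤m : 3 ≤ lookup r j₀
  3≤m = n>0⇒n≢1⇒n≢2⇒3≤n (generator-positive j₀) m≢1
    (multiplicity≢2 _ (least-generator-is-multiplicity j₀ j₀-least))
  f<rk : ¬ lookup r k < f → f < lookup r k
  f<rk rk≮f = ≤∧≢⇒< (≮⇒≥ rk≮f) (λ f≡rk → f∉Γ (unit k , trans (φ-unit r k) (sym f≡rk)))
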